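{- For any connected graphs $G_1$ and $G_2$, $$pd(G_1\times G_2)\leq pd(G_1)+pd(G_2).$$
   Context: All graphs are finite, simple and connected. For a connected graph $G=(V,E)$, $d(u,v)$ denotes the length of a shortest $u$–$v$ path, and for $v\in V$ and nonempty $P\subseteq V$, $d(v,P)=\min\{d(v,x):x\in P\}$. For an ordered partition $\Pi=\{P_1,\dots,P_t\}$ of $V$, the partition representation of $v$ is $r(v|\Pi)=(d(v,P_1),\dots,d(v,P_t))$; $\Pi$ is a resolving partition if $r(u|\Pi)\neq r(v|\Pi)$ for all distinct $u,v\in V$. The partition dimension $pd(G)$ is the minimum number of sets in a resolving partition of $G$. The Cartesian product $G_1\times G_2$ of $G_1=(V_1,E_1)$ and $G_2=(V_2,E_2)$ has vertex set $V_1\times V_2$, with $(a,b)$ adjacent to $(c,d)$ iff either $a=c$ and $bd\in E_2$, or $b=d$ and $ac\in E_1$. -}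

module Defs where

open import Data.Nat using (ℕ; zero; suc; _*_; _≤_; _<_)
open import Data.Fin using (Fin; _≟_; remQuot)
open import Data.Bool using (Bool; true; false; _∧_; _∨_)
open import Data.Product using (Σ; ∃; _×_; _,_)
open import Relation.Nullary using (¬_)
open import Relation.Nullary.Decidable using (⌊_⌋)
open import Relation.Binary.PropositionalEquality using (_≡_; _≢_)

record Graph : Set where
  constructor mkGraph
  field
    n   : ℕ
    adj : Fin n → Fin n → Bool
open Graph public

IsSimple : Graph → Set
IsSimple G = (∀ u v → adj G u v ≡ adj G v u) × (∀ u → adj G u u ≡ false)

data Walk (G : Graph) : Fin (n G) → Fin (n G) → ℕ → Set where
  nil  : ∀ {u} → Walk G u u 0
  cons : ∀ {u w v k} → adj G u w ≡ true → Walk G w v k → Walk G u v (suc k)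

Connected : Graph → Set
Connected G = (0 < n G) × (∀ u v → ∃ λ k → Walk G u v k)

Dist : (G : Graph) → Fin (n G) → Fin (n G) → ℕ → Set
Dist G u v k = Walk G u v k × (∀ m → Walk G u v m → k ≤ m)

SetDist : (G : Graph) → Fin (n G) → (Fin (n G) → Set) → ℕ → Set
SetDist G v P k =
  (Σ (Fin (n G)) λ x → P x × Dist G v x k) × (∀ x m → P x → Walk G v x m → k ≤ m)

record OrderedPartition (G : Graph) (t : ℕ) : Set where
  field
    cls      : Fin (n G) → Fin t
    nonempty : ∀ i → ∃ λ x → cls x ≡ i
open OrderedPartition public

Class : {G : Graph} {t : ℕ} → OrderedPartition G t → Fin t → Fin (n G) → Set
Class Π i x = cls Π x ≡ i

-- r(u|Π) ≠ r(v|Π): some coordinate d(·,P_i) differs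
RepDiffer : (G : Graph) {t : ℕ} → OrderedPartition G t → Fin (n G) → Fin (n G) → Set
RepDiffer G Π u v =
  Σ _ λ i → Σ ℕ λ a → Σ ℕ λ b →
    SetDist G u (Class Π i) a × SetDist G v (Class Π i) b × a ≢ b

IsResolving : (G : Graph) {t : ℕ} → OrderedPartition G t → Set
IsResolving G Π = ∀ u v → u ≢ v → RepDiffer G Π u v

IsPartitionDimension : Graph → ℕ → Set
IsPartitionDimension G k =
  (Σ (OrderedPartition G k) λ Π → IsResolving G Π) ×
  (∀ t → (Π : OrderedPartition G t) → IsResolving G Π → k ≤ t)

-- Cartesian product; vertex (a,b) ∈ Fin n₁ × Fin n₂ is encoded in Fin (n₁ * n₂) via remQuot
_□_ : Graph → Graph → Graph
G₁ □ G₂ = mkGraph (n G₁ * n G₂) A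
  where
  A : Fin (n G₁ * n G₂) → Fin (n G₁ * n G₂) → Bool
  A i j with remQuot {n G₁} (n G₂) i | remQuot {n G₁} (n G₂) j
  ... | (a , b) | (c , d) = (⌊ a ≟ c ⌋ ∧ adj G₂ b d) ∨ (⌊ b ≟ d ⌋ ∧ adj G₁ a c)

-- Let Π₁ = {P₁,…,Pₚ} and Π₂ = {Q₀,…,Q_q} resolve G₁ and G₂. In G₁ □ G₂ take the
-- classes Pᵢ × Q₀ and V₁ × Qⱼ (j ≥ 1), i.e. p + q sets. A walk in G₁ □ G₂ splits into
-- a walk in each factor, so d((a,b), A × B) = d(a, A) + d(b, B). Thus the
-- representation of (a,b) records d(b,Qⱼ) for j ≥ 1 and d(a,Pᵢ) + d(b,Q₀) for all i.
-- Taking i to be the class of a (where d(a,Pᵢ) = 0) shows that two vertices with equal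
-- representations have the same d(·,Q₀), hence the same representations in both
-- factors, hence are equal. So even pd(G₁ □ G₂) ≤ pd(G₁) + pd(G₂) − 1.
module Submission where

open import Defs
open import Data.Nat using (ℕ; zero; suc; _+_; _≤_; _<_; z≤n; s≤s)
open import Data.Nat.Properties
  using (≤-refl; ≤-antisym; ≮⇒≥; m<1+n⇒m<n∨m≡n; m≤n+m; +-suc; +-mono-≤;
         +-monoʳ-≤; +-cancelʳ-≡; n≤1+n; module ≤-Reasoning)
  renaming (_≟_ to _≟ℕ_)
open import Data.Fin using (Fin; zero; suc; _≟_; fromℕ<; remQuot; combine; splitAt; join)
open import Data.Fin.Properties
  using (remQuot-combine; combine-remQuot; splitAt-join; join-splitAt; any?; all?; ¬∀⟶∃¬)
open import Data.Bool using (Bool; true; false; _∧_; _∨_)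
open import Data.Bool.Properties using (∨-zeroʳ) renaming (_≟_ to _≟ᵇ_)
open import Data.Product using (Σ; ∃; _×_; _,_; proj₁; proj₂)
open import Data.Sum using (_⊎_; inj₁; inj₂)
open import Data.Unit using (tt)
open import Data.Empty using (⊥-elim)
open import Function using (_∘_)
open import Relation.Nullary using (¬_; Dec; yes; no)
open import Relation.Nullary.Decidable using (⌊_⌋; _×-dec_)
open import Relation.Unary using (U; _≐_; Decidable; Satisfiable)
open import Relation.Binary.PropositionalEquality
  using (_≡_; refl; sym; trans; cong; cong₂; subst; module ≡-Reasoning)

∧-∨-∧-true⁻ : {A B : Set} (A? : Dec A) (B? : Dec B) {x y : Bool} →
  (⌊ A? ⌋ ∧ x) ∨ (⌊ B? ⌋ ∧ y) ≡ true → (A × x ≡ true) ⊎ (B × y ≡ true)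
∧-∨-∧-true⁻ (yes a) _       {true}  _  = inj₁ (a , refl)
∧-∨-∧-true⁻ (yes _) (yes b) {false} eq = inj₂ (b , eq)
∧-∨-∧-true⁻ (no _)  (yes b)         eq = inj₂ (b , eq)
∧-∨-∧-true⁻ (yes _) (no _)  {false} ()
∧-∨-∧-true⁻ (no _)  (no _)          ()

∧-∨-∧-true⁺ : {A B : Set} (A? : Dec A) (B? : Dec B) {x y : Bool} →
  (A × x ≡ true) ⊎ (B × y ≡ true) → (⌊ A? ⌋ ∧ x) ∨ (⌊ B? ⌋ ∧ y) ≡ true
∧-∨-∧-true⁺ (yes _) _       (inj₁ (_ , refl)) = refl
∧-∨-∧-true⁺ (no ¬a) _       (inj₁ (a , _))    = ⊥-elim (¬a a)
∧-∨-∧-true⁺ _       (yes _) (inj₂ (_ , refl)) = ∨-zeroʳ _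
∧-∨-∧-true⁺ _       (no ¬b) (inj₂ (b , _))    = ⊥-elim (¬b b)

Minimal : (ℕ → Set) → ℕ → Set
Minimal Q m = Q m × (∀ m′ → Q m′ → m ≤ m′)

module _ {Q : ℕ → Set} (Q? : ∀ m → Dec (Q m)) where

  minimal-or-none-below : ∀ k → ∃ (Minimal Q) ⊎ (∀ m → m < k → ¬ Q m)
  minimal-or-none-below zero = inj₂ (λ _ ())
  minimal-or-none-below (suc k) with minimal-or-none-below k
  ... | inj₁ found = inj₁ found
  ... | inj₂ none with Q? k
  ...   | yes qk = inj₁ (k , qk , λ m qm → ≮⇒≥ (λ m<k → none m m<k qm))
  ...   | no ¬qk = inj₂ (λ m m<1+k → none-below-or-at (m<1+n⇒m<n∨m≡n m<1+k))
    where
    none-below-or-at : ∀ {m} → m < k ⊎ m ≡ k → ¬ Q m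
    none-below-or-at (inj₁ m<k)  = none _ m<k
    none-below-or-at (inj₂ refl) = ¬qk

  minimal-exists : ∀ {k} → Q k → ∃ (Minimal Q)
  minimal-exists {k} qk with minimal-or-none-below (suc k)
  ... | inj₁ found = found
  ... | inj₂ none  = ⊥-elim (none k (s≤s ≤-refl) qk)

module _ {G : Graph} where

  _++ʷ_ : ∀ {u v w k l} → Walk G u v k → Walk G v w l → Walk G u w (k + l)
  nil      ++ʷ q = q
  cons e p ++ʷ q = cons e (p ++ʷ q)

  setDist-intro : ∀ {v P k} x → P x → Walk G v x k →
    (∀ y m → P y → Walk G v y m → k ≤ m) → SetDist G v P k
  setDist-intro x px w min = (x , px , w , (λ m w′ → min x m px w′)) , min

  setDist-unique : ∀ {v P a b} → SetDist G v P a → SetDist G v P b → a ≡ b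
  setDist-unique ((x , px , wx , _) , minA) ((y , py , wy , _) , minB) =
    ≤-antisym (minA y _ py wy) (minB x _ px wx)

  setDist-member : ∀ {v} {P : Fin (n G) → Set} → P v → SetDist G v P 0
  setDist-member pv = setDist-intro _ pv nil (λ _ _ _ _ → z≤n)

  setDist-resp-≐ : ∀ {v k} {P Q : Fin (n G) → Set} → P ≐ Q → SetDist G v P k → SetDist G v Q k
  setDist-resp-≐ (P⊆Q , Q⊆P) ((x , px , wx , _) , min) =
    setDist-intro x (P⊆Q px) wx (λ y m qy → min y m (Q⊆P qy))

walk? : (G : Graph) → ∀ k u v → Dec (Walk G u v k)
walk? G zero u v with u ≟ v
... | yes refl = yes nil
... | no u≢v   = no λ { nil → u≢v refl }
walk? G (suc k) u v with any? (λ w → (adj G u w ≟ᵇ true) ×-dec walk? G k w v)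
... | yes (w , e , p) = yes (cons e p)
... | no ¬step        = no λ { (cons e p) → ¬step (_ , e , p) }

setDist-exists : {G : Graph} → Connected G → {P : Fin (n G) → Set} →
  Decidable P → Satisfiable P → ∀ v → ∃ (SetDist G v P)
setDist-exists {G} (_ , connected) P? (x , px) v
  with minimal-exists (λ m → any? (λ y → P? y ×-dec walk? G m v y)) (x , px , proj₂ (connected v x))
... | m , (y , py , w) , min = m , setDist-intro y py w (λ y′ m′ py′ w′ → min m′ (y′ , py′ , w′))

module _ {G : Graph} {t : ℕ} (Π : OrderedPartition G t) where

  resolving⇒distances-injective : IsResolving G Π → (D : Fin (n G) → Fin t → ℕ) →
    (∀ x i → SetDist G x (Class Π i) (D x i)) → ∀ u v → (∀ i → D u i ≡ D v i) → u ≡ v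
  resolving⇒distances-injective resolving D D-spec u v same with u ≟ v
  ... | yes u≡v = u≡v
  ... | no u≢v with resolving u v u≢v
  ... | i , a , b , du , dv , a≢b =
    ⊥-elim (a≢b (trans (setDist-unique du (D-spec u i))
                       (trans (same i) (setDist-unique (D-spec v i) dv))))

  distances-injective⇒resolving : (D : Fin (n G) → Fin t → ℕ) →
    (∀ x i → SetDist G x (Class Π i) (D x i)) →
    (∀ u v → (∀ i → D u i ≡ D v i) → u ≡ v) → IsResolving G Π
  distances-injective⇒resolving D D-spec injective u v u≢v
    with all? (λ i → D u i ≟ℕ D v i)
  ... | yes same = ⊥-elim (u≢v (injective u v same))
  ... | no ¬same with ¬∀⟶∃¬ t _ (λ i → D u i ≟ℕ D v i) ¬same
  ... | i , differ = i , D u i , D v i , D-spec u i , D-spec v i , differ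

module _ {G : Graph} (connected : Connected G) {t : ℕ} (Π : OrderedPartition G t) where

  classDist : Fin (n G) → Fin t → ℕ
  classDist v i = proj₁ (setDist-exists connected (λ x → cls Π x ≟ i) (nonempty Π i) v)

  classDist-spec : ∀ v i → SetDist G v (Class Π i) (classDist v i)
  classDist-spec v i = proj₂ (setDist-exists connected (λ x → cls Π x ≟ i) (nonempty Π i) v)

  classDist-own : ∀ v → classDist v (cls Π v) ≡ 0
  classDist-own v = setDist-unique (classDist-spec v (cls Π v)) (setDist-member refl)

module CartesianProduct (G₁ G₂ : Graph) where

  private
    G : Graph
    G = G₁ □ G₂

    V : Set
    V = Fin (n G)

  π₁ : V → Fin (n G₁)
  π₁ u = proj₁ (remQuot {n G₁} (n G₂) u)

  π₂ : V → Fin (n G₂)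
  π₂ u = proj₂ (remQuot {n G₁} (n G₂) u)

  π-combine : ∀ a b → (π₁ (combine a b) , π₂ (combine a b)) ≡ (a , b)
  π-combine a b = remQuot-combine a b

  combine-π : ∀ u → combine (π₁ u) (π₂ u) ≡ u
  combine-π u = combine-remQuot {n G₁} (n G₂) u

  □-adj : ∀ u v → adj G u v ≡
    (⌊ π₁ u ≟ π₁ v ⌋ ∧ adj G₂ (π₂ u) (π₂ v)) ∨ (⌊ π₂ u ≟ π₂ v ⌋ ∧ adj G₁ (π₁ u) (π₁ v))
  □-adj u v with remQuot {n G₁} (n G₂) u | remQuot {n G₁} (n G₂) v
  ... | _ | _ = refl

  □-adj-combine : ∀ a b c d → adj G (combine a b) (combine c d) ≡
    (⌊ a ≟ c ⌋ ∧ adj G₂ b d) ∨ (⌊ b ≟ d ⌋ ∧ adj G₁ a c)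
  □-adj-combine a b c d =
    trans (□-adj (combine a b) (combine c d)) (cong₂ adjacency (π-combine a b) (π-combine c d))
    where
    adjacency : Fin (n G₁) × Fin (n G₂) → Fin (n G₁) × Fin (n G₂) → Bool
    adjacency (a , b) (c , d) = (⌊ a ≟ c ⌋ ∧ adj G₂ b d) ∨ (⌊ b ≟ d ⌋ ∧ adj G₁ a c)

  □-edge⁻ : ∀ {u v} → adj G u v ≡ true →
    (π₁ u ≡ π₁ v × adj G₂ (π₂ u) (π₂ v) ≡ true) ⊎ (π₂ u ≡ π₂ v × adj G₁ (π₁ u) (π₁ v) ≡ true)
  □-edge⁻ {u} {v} e = ∧-∨-∧-true⁻ (π₁ u ≟ π₁ v) (π₂ u ≟ π₂ v) (trans (sym (□-adj u v)) e)

  walk-□-split : ∀ {u v k} → Walk G u v k → Σ ℕ λ k₁ → Σ ℕ λ k₂ →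
    Walk G₁ (π₁ u) (π₁ v) k₁ × Walk G₂ (π₂ u) (π₂ v) k₂ × k₁ + k₂ ≡ k
  walk-□-split nil = 0 , 0 , nil , nil , refl
  walk-□-split (cons e p) with walk-□-split p | □-edge⁻ e
  ... | k₁ , k₂ , p₁ , p₂ , refl | inj₁ (same₁ , e₂) =
    k₁ , suc k₂ , subst (λ a → Walk G₁ a _ k₁) (sym same₁) p₁ , cons e₂ p₂ , +-suc k₁ k₂
  ... | k₁ , k₂ , p₁ , p₂ , refl | inj₂ (same₂ , e₁) =
    suc k₁ , k₂ , cons e₁ p₁ , subst (λ b → Walk G₂ b _ k₂) (sym same₂) p₂ , refl

  walk-□-lift₁ : ∀ {a c k} b → Walk G₁ a c k → Walk G (combine a b) (combine c b) k
  walk-□-lift₁ b nil = nil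
  walk-□-lift₁ {a} b (cons {w = a′} e p) =
    cons (trans (□-adj-combine a b a′ b) (∧-∨-∧-true⁺ (a ≟ a′) (b ≟ b) (inj₂ (refl , e))))
         (walk-□-lift₁ b p)

  walk-□-lift₂ : ∀ {b d k} (a : Fin (n G₁)) → Walk G₂ b d k → Walk G (combine a b) (combine a d) k
  walk-□-lift₂ a nil = nil
  walk-□-lift₂ {b} a (cons {w = b′} e p) =
    cons (trans (□-adj-combine a b a b′) (∧-∨-∧-true⁺ (a ≟ a) (b ≟ b′) (inj₁ (refl , e))))
         (walk-□-lift₂ a p)

  walk-□ : ∀ {u a b k₁ k₂} → Walk G₁ (π₁ u) a k₁ → Walk G₂ (π₂ u) b k₂ →
    Walk G u (combine a b) (k₁ + k₂)
  walk-□ {u} {a} {b} {k₁} {k₂} p₁ p₂ =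
    subst (λ w → Walk G w (combine a b) (k₁ + k₂)) (combine-π u)
      (walk-□-lift₁ (π₂ u) p₁ ++ʷ walk-□-lift₂ a p₂)

  setDist-□ : ∀ {u k₁ k₂} {P₁ : Fin (n G₁) → Set} {P₂ : Fin (n G₂) → Set} →
    SetDist G₁ (π₁ u) P₁ k₁ → SetDist G₂ (π₂ u) P₂ k₂ →
    SetDist G u (λ x → P₁ (π₁ x) × P₂ (π₂ x)) (k₁ + k₂)
  setDist-□ {u} {k₁} {k₂} {P₁} {P₂} ((a , pa , wa , _) , min₁) ((b , pb , wb , _) , min₂) =
    setDist-intro (combine a b)
      (subst (λ (a , b) → P₁ a × P₂ b) (sym (π-combine a b)) (pa , pb))
      (walk-□ wa wb)
      lower-bound
    where
    lower-bound : ∀ x m → P₁ (π₁ x) × P₂ (π₂ x) → Walk G u x m → k₁ + k₂ ≤ m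
    lower-bound x m (px₁ , px₂) w with walk-□-split w
    ... | m₁ , m₂ , w₁ , w₂ , refl = +-mono-≤ (min₁ (π₁ x) m₁ px₁ w₁) (min₂ (π₂ x) m₂ px₂ w₂)

module ProductPartition {G₁ G₂ : Graph} (connected₁ : Connected G₁) (connected₂ : Connected G₂)
  {p₁ q : ℕ} (Π₁ : OrderedPartition G₁ p₁) (Π₂ : OrderedPartition G₂ (suc q)) where

  open CartesianProduct G₁ G₂

  private
    G : Graph
    G = G₁ □ G₂

    d₁ : Fin (n G₁) → Fin p₁ → ℕ
    d₁ = classDist connected₁ Π₁

    d₂ : Fin (n G₂) → Fin (suc q) → ℕ
    d₂ = classDist connected₂ Π₂

  -- inj₁ i labels the class Pᵢ × Q₀, and inj₂ j labels V₁ × Q₍ⱼ₊₁₎.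
  label : Fin p₁ → Fin (suc q) → Fin p₁ ⊎ Fin q
  label i zero    = inj₁ i
  label _ (suc j) = inj₂ j

  label≡inj₁ : ∀ {c d i} → label c d ≡ inj₁ i → c ≡ i × d ≡ zero
  label≡inj₁ {d = zero} refl = refl , refl

  label≡inj₂ : ∀ {c d j} → label c d ≡ inj₂ j → d ≡ suc j
  label≡inj₂ {d = suc _} refl = refl

  labelOf : Fin (n G) → Fin p₁ ⊎ Fin q
  labelOf x = label (cls Π₁ (π₁ x)) (cls Π₂ (π₂ x))

  labelOf-combine : ∀ a b → labelOf (combine a b) ≡ label (cls Π₁ a) (cls Π₂ b)
  labelOf-combine a b = cong (λ (a , b) → label (cls Π₁ a) (cls Π₂ b)) (π-combine a b)

  labelOf-surjective : ∀ s → ∃ λ x → labelOf x ≡ s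
  labelOf-surjective (inj₁ i) with nonempty Π₁ i | nonempty Π₂ zero
  ... | a , refl | b , b∈Q₀ = combine a b , trans (labelOf-combine a b) (cong (label _) b∈Q₀)
  labelOf-surjective (inj₂ j) with nonempty Π₂ (suc j)
  ... | b , b∈Qⱼ₊₁ =
    combine (fromℕ< (proj₁ connected₁)) b , trans (labelOf-combine _ b) (cong (label _) b∈Qⱼ₊₁)

  productPartition : OrderedPartition G (p₁ + q)
  cls productPartition = join p₁ q ∘ labelOf
  nonempty productPartition k with labelOf-surjective (splitAt p₁ k)
  ... | x , labelled = x , trans (cong (join p₁ q) labelled) (join-splitAt p₁ q k)

  Class≐labelOf : ∀ k → (λ x → labelOf x ≡ splitAt p₁ k) ≐ Class productPartition k
  Class≐labelOf k = (λ labelled → trans (cong (join p₁ q) labelled) (join-splitAt p₁ q k))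
                  , (λ joined → trans (sym (splitAt-join p₁ q _)) (cong (splitAt p₁) joined))

  labelDist : Fin (n G) → Fin p₁ ⊎ Fin q → ℕ
  labelDist u (inj₁ i) = d₁ (π₁ u) i + d₂ (π₂ u) zero
  labelDist u (inj₂ j) = d₂ (π₂ u) (suc j)

  labelDist-spec : ∀ u s → SetDist G u (λ x → labelOf x ≡ s) (labelDist u s)
  labelDist-spec u (inj₁ i) =
    setDist-resp-≐ ((λ (c≡i , d≡0) → cong₂ label c≡i d≡0) , label≡inj₁)
      (setDist-□ (classDist-spec connected₁ Π₁ (π₁ u) i) (classDist-spec connected₂ Π₂ (π₂ u) zero))
  labelDist-spec u (inj₂ j) =
    setDist-resp-≐ ((λ (_ , d≡1+j) → cong (label _) d≡1+j) , λ eq → tt , label≡inj₂ eq)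
      (setDist-□ {P₁ = U} (setDist-member tt) (classDist-spec connected₂ Π₂ (π₂ u) (suc j)))

  productDist : Fin (n G) → Fin (p₁ + q) → ℕ
  productDist u k = labelDist u (splitAt p₁ k)

  productDist-spec : ∀ u k → SetDist G u (Class productPartition k) (productDist u k)
  productDist-spec u k = setDist-resp-≐ (Class≐labelOf k) (labelDist-spec u (splitAt p₁ k))

  Q₀-dist-≤ : ∀ u v → (∀ i → labelDist u (inj₁ i) ≡ labelDist v (inj₁ i)) →
    d₂ (π₂ v) zero ≤ d₂ (π₂ u) zero
  Q₀-dist-≤ u v same = begin
    d₂ (π₂ v) zero                   ≤⟨ m≤n+m _ _ ⟩
    d₁ (π₁ v) a₁ + d₂ (π₂ v) zero    ≡⟨ same a₁ ⟨
    d₁ (π₁ u) a₁ + d₂ (π₂ u) zero    ≡⟨ cong (_+ d₂ (π₂ u) zero) (classDist-own connected₁ Π₁ (π₁ u)) ⟩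
    d₂ (π₂ u) zero                   ∎
    where
    open ≤-Reasoning
    a₁ : Fin p₁
    a₁ = cls Π₁ (π₁ u)

  module _ (resolving₁ : IsResolving G₁ Π₁) (resolving₂ : IsResolving G₂ Π₂) where

    labelDist-injective : ∀ u v → (∀ s → labelDist u s ≡ labelDist v s) → u ≡ v
    labelDist-injective u v same = begin
      u                        ≡⟨ combine-π u ⟨
      combine (π₁ u) (π₂ u)    ≡⟨ cong₂ combine same-π₁ same-π₂ ⟩
      combine (π₁ v) (π₂ v)    ≡⟨ combine-π v ⟩
      v                        ∎
      where
      open ≡-Reasoning
      same-Q₀ : d₂ (π₂ u) zero ≡ d₂ (π₂ v) zero
      same-Q₀ = ≤-antisym (Q₀-dist-≤ v u (sym ∘ same ∘ inj₁)) (Q₀-dist-≤ u v (same ∘ inj₁))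
      same-d₁ : ∀ i → d₁ (π₁ u) i ≡ d₁ (π₁ v) i
      same-d₁ i = +-cancelʳ-≡ _ _ _ (trans (same (inj₁ i)) (cong (d₁ (π₁ v) i +_) (sym same-Q₀)))
      same-d₂ : ∀ j → d₂ (π₂ u) j ≡ d₂ (π₂ v) j
      same-d₂ zero    = same-Q₀
      same-d₂ (suc j) = same (inj₂ j)
      same-π₁ : π₁ u ≡ π₁ v
      same-π₁ = resolving⇒distances-injective Π₁ resolving₁ d₁ (classDist-spec connected₁ Π₁) _ _ same-d₁
      same-π₂ : π₂ u ≡ π₂ v
      same-π₂ = resolving⇒distances-injective Π₂ resolving₂ d₂ (classDist-spec connected₂ Π₂) _ _ same-d₂

    productPartition-resolving : IsResolving G productPartition
    productPartition-resolving =
      distances-injective⇒resolving productPartition productDist productDist-spec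
        λ u v same → labelDist-injective u v λ s →
          subst (λ s′ → labelDist u s′ ≡ labelDist v s′) (splitAt-join p₁ q s) (same (join p₁ q s))

theorem1 : (G₁ G₂ : Graph) → IsSimple G₁ → IsSimple G₂ → Connected G₁ → Connected G₂ →
    (p₁ p₂ p : ℕ) → IsPartitionDimension G₁ p₁ → IsPartitionDimension G₂ p₂ →
    IsPartitionDimension (G₁ □ G₂) p → p ≤ p₁ + p₂
theorem1 G₁ G₂ _ _ connected₁ connected₂ p₁ zero p _ ((Π₂ , _) , _) _
  with () ← cls Π₂ (fromℕ< (proj₁ connected₂))
theorem1 G₁ G₂ _ _ connected₁ connected₂ p₁ (suc q) p ((Π₁ , resolving₁) , _) ((Π₂ , resolving₂) , _)
  (_ , pd-minimal) = begin
    p           ≤⟨ pd-minimal (p₁ + q) productPartition (productPartition-resolving resolving₁ resolving₂) ⟩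
    p₁ + q      ≤⟨ +-monoʳ-≤ p₁ (n≤1+n q) ⟩
    p₁ + suc q  ∎
  where
  open ProductPartition connected₁ connected₂ Π₁ Π₂
  open ≤-Reasoning
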